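{- Let $w$ be a permutation of $\mathbb Z_{>0}$ fixing all but finitely many integers, and $i\in\mathbb Z_{>0}$. (1) For $U,U'\subseteq\phi_i(w)$, $w_{U,i}\le w_{U',i}$ if and only if $U\subseteq U'$; consequently $\{w\}\cup\overline\Phi_i(w)$, as a subposet of Bruhat order, is a Boolean lattice. (2) $[w,\vee\Phi_i(w)]=\{w\}\cup\overline\Phi_i(w)$, where $\vee\Phi_i(w)$ is the join (least upper bound) of $\Phi_i(w)$ in Bruhat order and $[u,v]=\{x:u\le x\le v\}$.
   Context: $\le$ is Bruhat order on the group of permutations of $\mathbb Z_{>0}$ fixing all but finitely many integers; $t_{a,b}=(a\ b)$. $\phi_i(w)=\{a>i:w(a)>w(i)$, and there is no $a'$ with $i<a'<a$ and $w(i)<w(a')<w(a)\}$. $\Phi_i(w)=\{wt_{i,a}:a\in\phi_i(w)\}$. For $U=\{i_1<\cdots<i_k\}\subseteq\phi_i(w)$, $w_{U,i}=wt_{i,i_k}t_{i,i_{k-1}}\cdots t_{i,i_1}$, with $w_{\emptyset,i}=w$; $\overline\Phi_i(w)=\{w_{U,i}:\emptyset\ne U\subseteq\phi_i(w)\}$. A Boolean lattice is a poset isomorphic to the lattice of subsets of a finite set ordered by inclusion. -}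

module Defs where

open import Data.Nat using (ℕ; _<_; _≤_; _≡ᵇ_)
open import Data.Bool using (if_then_else_)
open import Data.Product using (Σ; _×_; ∃; ∃-syntax)
open import Data.Sum using (_⊎_)
open import Data.List using (List; []; _∷_)
open import Data.List.Membership.Propositional using (_∈_)
open import Data.List.Relation.Unary.All using (All)
open import Data.List.Relation.Unary.Linked using (Linked)
open import Data.Fin.Subset using (Subset) renaming (_⊆_ to _⊆ₛ_)
open import Function using (_∘_; id)
open import Function.Bundles using (_⇔_)
open import Relation.Nullary using (¬_)
open import Relation.Binary.PropositionalEquality using (_≡_; _≢_; _≗_)

-- Convention: the positive integer k is encoded as the natural number k - 1
-- (an order isomorphism ℤ>0 ≅ ℕ), so all notions below transfer verbatim.

record Perm : Set where
  field
    fun      : ℕ → ℕ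
    inv      : ℕ → ℕ
    fun∘inv  : ∀ a → fun (inv a) ≡ a
    inv∘fun  : ∀ a → inv (fun a) ≡ a
    bound    : ℕ
    fixed    : ∀ a → bound ≤ a → fun a ≡ a
open Perm public

t : ℕ → ℕ → ℕ → ℕ
t a b x = if x ≡ᵇ a then b else (if x ≡ᵇ b then a else x)

-- Bruhat covering-type step: v = u t_{a,b} with a < b and u(a) < u(b)
-- (equivalently ℓ(u t_{a,b}) > ℓ(u)).
BStep : (ℕ → ℕ) → (ℕ → ℕ) → Set
BStep u v = Σ ℕ λ a → Σ ℕ λ b → a < b × u a < u b × v ≗ (u ∘ t a b)

data _≤B_ : (ℕ → ℕ) → (ℕ → ℕ) → Set where
  ≤B-refl : ∀ {u v} → u ≗ v → u ≤B v
  ≤B-step : ∀ {u x v} → u ≤B x → BStep x v → u ≤B v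

_≤P_ : Perm → Perm → Set
x ≤P y = fun x ≤B fun y

InPhi : Perm → ℕ → ℕ → Set
InPhi w i a = i < a × fun w i < fun w a
            × (∀ a' → i < a' → a' < a → ¬ (fun w i < fun w a' × fun w a' < fun w a))

-- a finite subset U ⊆ φ_i(w), given as its strictly increasing list of elements
SubPhi : Perm → ℕ → List ℕ → Set
SubPhi w i U = Linked _<_ U × All (InPhi w i) U

-- w_{U,i} = w t_{i,i_k} ⋯ t_{i,i_1} for U = [i_1 < ⋯ < i_k]
wU : Perm → ℕ → List ℕ → ℕ → ℕ
wU w i []       = fun w
wU w i (u ∷ us) = wU w i us ∘ t i u

_⊆L_ : List ℕ → List ℕ → Set
U ⊆L U' = ∀ {a} → a ∈ U → a ∈ U'

InΦ : Perm → ℕ → Perm → Set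
InΦ w i x = Σ ℕ λ a → InPhi w i a × fun x ≗ (fun w ∘ t i a)

InWΦ̄ : Perm → ℕ → Perm → Set
InWΦ̄ w i x = fun x ≗ fun w
            ⊎ Σ (List ℕ) λ U → SubPhi w i U × U ≢ [] × fun x ≗ wU w i U

-- The subposet (of Bruhat order) P is a Boolean lattice: it is isomorphic as a poset
-- to the lattice of subsets of a finite set Fin n ordered by inclusion
-- (elements of P identified up to equality of the underlying permutations).
IsBooleanLattice : (Perm → Set) → Set
IsBooleanLattice P =
  Σ ℕ λ n → Σ (Subset n → Perm) λ f →
      (∀ S → P (f S))
    × (∀ x → P x → Σ (Subset n) λ S → fun (f S) ≗ fun x)
    × (∀ S T → fun (f S) ≗ fun (f T) → S ≡ T)
    × (∀ S T → (f S ≤P f T) ⇔ (S ⊆ₛ T))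

IsJoin : (Perm → Set) → Perm → Set
IsJoin S v = (∀ x → S x → x ≤P v)
           × (∀ z → (∀ x → S x → x ≤P z) → v ≤P z)

-- Let rank f p q count the x < p with f x < q. Composing f with t_{c,d} (c < d, f c < f d) lowers
-- rank f by one exactly on the box (c,d] × (f c, f d], and conversely u ≤ v in Bruhat order as soon
-- as rank v ≤ rank u everywhere (exchange u at its first difference with v until they agree).
-- For U ⊆ φ_i(w) listed increasingly these boxes fit together, so rank w − rank w_{U,i} is the
-- indicator of the staircase ⋃_{u ∈ U} (i,u] × (w i, w u], whose corners are the points (u, w u).
-- Comparing staircases gives w_{U,i} ≤ w_{U',i} ⟺ U ⊆ U' and shows that w_{φ_i(w),i} is the join of
-- Φ_i(w). Along a Bruhat chain from w below that join, each step removes a box that must fit inside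
-- the staircase of φ_i(w) but outside that of the current U; its corners force the box to be the
-- new step of the staircase of U ∪ {d} for some d ∈ φ_i(w), so the chain never leaves {w} ∪ Φ̄_i(w).

module Submission where

open import Defs
open import Data.Bool using (true; false; T)
open import Data.Empty using (⊥-elim)
open import Data.Fin.Subset using (Subset) renaming (_⊆_ to _⊆ₛ_)
open import Data.Fin.Subset.Properties using (drop-∷-⊆; ⊆-antisym)
open import Data.List using (List; []; _∷_; filter; upTo; length)
open import Data.List.Properties using (filter-all; filter-accept; filter-reject)
open import Data.List.Membership.Propositional using (_∈_; _∉_; find; lose)
open import Data.List.Membership.Propositional.Properties using (∈-filter⁺; ∈-filter⁻; ∈-upTo⁺)
open import Data.List.Relation.Unary.All as All using (All; []; _∷_)
import Data.List.Relation.Unary.All.Properties as All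
open import Data.List.Relation.Unary.AllPairs using (AllPairs; []; _∷_)
import Data.List.Relation.Unary.AllPairs.Properties as AllPairs
open import Data.List.Relation.Unary.Any using (Any; here; there; any?)
open import Data.List.Relation.Unary.Linked.Properties using (Linked⇒AllPairs; AllPairs⇒Linked)
open import Data.Nat hiding (_≟_)
open import Data.Nat.Properties
open import Algebra.Properties.CommutativeSemigroup +-commutativeSemigroup
  using (interchange; x∙yz≈xz∙y; xy∙z≈xz∙y)
open import Data.List.Membership.DecPropositional _≟_ using (_∈?_)
open import Data.Product using (Σ; _×_; _,_; proj₁; proj₂; ∃)
open import Data.Sum using (_⊎_; inj₁; inj₂; [_,_]; [_,_]′)
open import Data.Unit using (tt)
open import Data.Vec using ([]; _∷_; here; there)
open import Function using (_∘_)
open import Function.Bundles using (_⇔_; mk⇔; Equivalence)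
open import Level using (Level)
open import Relation.Binary.Definitions using (tri<; tri≈; tri>)
open import Relation.Binary.PropositionalEquality hiding ([_])
open import Relation.Nullary using (Dec; does; yes; no; ¬_; ¬?; _×-dec_; map′; decidable-stable)
open import Relation.Unary using (Decidable)

t-fst : ∀ a b → t a b a ≡ b
t-fst a b with a ≡ᵇ a | ≡⇒≡ᵇ a a refl
... | true | _ = refl

t-snd : ∀ a b → t a b b ≡ a
t-snd a b with b ≡ᵇ a in eq
... | true  = ≡ᵇ⇒≡ b a (subst T (sym eq) tt)
... | false with b ≡ᵇ b | ≡⇒≡ᵇ b b refl
...   | true | _ = refl

t-fix : ∀ a b x → x ≢ a → x ≢ b → t a b x ≡ x
t-fix a b x x≢a x≢b with x ≡ᵇ a in e₁
... | true  = ⊥-elim (x≢a (≡ᵇ⇒≡ x a (subst T (sym e₁) tt)))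
... | false with x ≡ᵇ b in e₂
...   | true  = ⊥-elim (x≢b (≡ᵇ⇒≡ x b (subst T (sym e₂) tt)))
...   | false = refl

t-fix-from : ∀ {a b N x} → a < N → b < N → N ≤ x → t a b x ≡ x
t-fix-from a<N b<N N≤x = t-fix _ _ _ (λ { refl → <⇒≱ a<N N≤x }) (λ { refl → <⇒≱ b<N N≤x })

t-involutive : ∀ a b x → t a b (t a b x) ≡ x
t-involutive a b x with x ≟ a | x ≟ b
... | yes refl | _        = trans (cong (t a b) (t-fst a b)) (t-snd a b)
... | no _     | yes refl = trans (cong (t a b) (t-snd a b)) (t-fst a b)
... | no x≢a   | no x≢b   = trans (cong (t a b) (t-fix a b x x≢a x≢b)) (t-fix a b x x≢a x≢b)

private variable
  ℓ ℓ′ ℓ″ : Level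
  P : Set ℓ
  Q : Set ℓ′
  C : Set ℓ″

𝟙 : Dec P → ℕ
𝟙 (yes _) = 1
𝟙 (no _)  = 0

𝟙-yes : (P? : Dec P) → P → 𝟙 P? ≡ 1
𝟙-yes (yes _) _  = refl
𝟙-yes (no ¬p) p′ = ⊥-elim (¬p p′)

𝟙-no : (P? : Dec P) → ¬ P → 𝟙 P? ≡ 0
𝟙-no (yes p′) ¬p = ⊥-elim (¬p p′)
𝟙-no (no _)   _  = refl

𝟙≤1 : (P? : Dec P) → 𝟙 P? ≤ 1
𝟙≤1 (yes _) = ≤-refl
𝟙≤1 (no _)  = z≤n

1≤𝟙⇒ : (P? : Dec P) → 1 ≤ 𝟙 P? → P
1≤𝟙⇒ (yes p′) _ = p′

𝟙-mono : (P? : Dec P) (Q? : Dec Q) → (P → Q) → 𝟙 P? ≤ 𝟙 Q?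
𝟙-mono (yes p′) Q? P⇒Q = ≤-reflexive (sym (𝟙-yes Q? (P⇒Q p′)))
𝟙-mono (no _)   _  _   = z≤n

𝟙-cong : (P? : Dec P) (Q? : Dec Q) → (P → Q) → (Q → P) → 𝟙 P? ≡ 𝟙 Q?
𝟙-cong P? Q? P⇒Q Q⇒P = ≤-antisym (𝟙-mono P? Q? P⇒Q) (𝟙-mono Q? P? Q⇒P)

𝟙-⊎ : (P? : Dec P) (Q? : Dec Q) (C? : Dec C) →
      (P ⊎ Q → C) → (C → P ⊎ Q) → ¬ (P × Q) → 𝟙 P? + 𝟙 Q? ≡ 𝟙 C?
𝟙-⊎ (yes p′) (yes q′) _  _  _  disj = ⊥-elim (disj (p′ , q′))
𝟙-⊎ (yes p′) (no _)   C? to _  _    = sym (𝟙-yes C? (to (inj₁ p′)))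
𝟙-⊎ (no _)   (yes q′) C? to _  _    = sym (𝟙-yes C? (to (inj₂ q′)))
𝟙-⊎ (no ¬p)  (no ¬q)  C? _  from _  = sym (𝟙-no C? ([ ¬p , ¬q ] ∘ from))

count : {P : ℕ → Set ℓ} → Decidable P → ℕ → ℕ
count P? zero    = 0
count P? (suc p) = 𝟙 (P? p) + count P? p

module _ {P : ℕ → Set ℓ} {Q : ℕ → Set ℓ′} (P? : Decidable P) (Q? : Decidable Q) where

  count-cong : ∀ p → (∀ x → x < p → P x → Q x) → (∀ x → x < p → Q x → P x) → count P? p ≡ count Q? p
  count-cong zero    _   _   = refl
  count-cong (suc p) P⇒Q Q⇒P = cong₂ _+_ (𝟙-cong (P? p) (Q? p) (P⇒Q p ≤-refl) (Q⇒P p ≤-refl))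
    (count-cong p (λ x x<p → P⇒Q x (m<n⇒m<1+n x<p)) (λ x x<p → Q⇒P x (m<n⇒m<1+n x<p)))

  count-⊎ : {C : ℕ → Set ℓ″} (C? : Decidable C) → ∀ p →
            (∀ x → P x ⊎ Q x → C x) → (∀ x → C x → P x ⊎ Q x) → (∀ x → ¬ (P x × Q x)) →
            count P? p + count Q? p ≡ count C? p
  count-⊎ C? zero    _  _    _    = refl
  count-⊎ C? (suc p) to from disj = begin
    (𝟙 (P? p) + count P? p) + (𝟙 (Q? p) + count Q? p)  ≡⟨ interchange (𝟙 (P? p)) _ _ _ ⟩
    (𝟙 (P? p) + 𝟙 (Q? p)) + (count P? p + count Q? p)  ≡⟨ cong₂ _+_ (𝟙-⊎ (P? p) (Q? p) (C? p) (to p) (from p) (disj p))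
                                                                     (count-⊎ C? p to from disj) ⟩
    𝟙 (C? p) + count C? p                              ∎
    where open ≡-Reasoning

module _ {P : ℕ → Set ℓ} (P? : Decidable P) where

  count-mono : ∀ {p p′} → p ≤ p′ → count P? p ≤ count P? p′
  count-mono {p′ = zero}   z≤n     = ≤-refl
  count-mono {p′ = suc p′} p≤1+p′ with m≤n⇒m<n∨m≡n p≤1+p′
  ... | inj₁ p<1+p′ = ≤-trans (count-mono (≤-pred p<1+p′)) (m≤n+m _ _)
  ... | inj₂ refl   = ≤-refl

  count-gap : ∀ {a p} → a ≤ p → (∀ x → a ≤ x → x < p → ¬ P x) → count P? p ≡ count P? a
  count-gap {p = zero}  z≤n      _    = refl
  count-gap {p = suc p} a≤1+p    none with m≤n⇒m<n∨m≡n a≤1+p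
  ... | inj₂ refl   = refl
  ... | inj₁ a<1+p  = cong₂ _+_ (𝟙-no (P? p) (none p (≤-pred a<1+p) ≤-refl))
                        (count-gap (≤-pred a<1+p) (λ x a≤x x<p → none x a≤x (m<n⇒m<1+n x<p)))

rank : (ℕ → ℕ) → ℕ → ℕ → ℕ
rank f p q = count (λ x → f x <? q) p

rank-agree : ∀ {f g} p → (∀ x → x < p → f x ≡ g x) → ∀ q → rank f p q ≡ rank g p q
rank-agree p f≡g q = count-cong _ _ p (λ x x<p → subst (_< q) (f≡g x x<p)) (λ x x<p → subst (_< q) (sym (f≡g x x<p)))

rank-cong : ∀ {f g} → f ≗ g → ∀ p q → rank f p q ≡ rank g p q
rank-cong f≗g p = rank-agree p (λ x _ → f≗g x)

same-rank⇒≮ : ∀ {f g} → (∀ p q → rank f p q ≡ rank g p q) → ∀ c → g c ≮ f c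
same-rank⇒≮ {f} {g} same c gc<fc = 1+n≢n (begin
  1 + rank g c (f c)               ≡⟨ cong (_+ rank g c (f c)) (sym (𝟙-yes (g c <? f c) gc<fc)) ⟩
  rank g (suc c) (f c)             ≡⟨ sym (same (suc c) (f c)) ⟩
  𝟙 (f c <? f c) + rank f c (f c)  ≡⟨ cong₂ _+_ (𝟙-no (f c <? f c) (<-irrefl refl)) (same c (f c)) ⟩
  rank g c (f c)                   ∎)
  where open ≡-Reasoning

rank-injective : ∀ {f g} → (∀ p q → rank f p q ≡ rank g p q) → f ≗ g
rank-injective {f} {g} same c with <-cmp (f c) (g c)
... | tri≈ _ fc≡gc _ = fc≡gc
... | tri< fc<gc _ _ = ⊥-elim (same-rank⇒≮ (λ p q → sym (same p q)) c fc<gc)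
... | tri> _ _ gc<fc = ⊥-elim (same-rank⇒≮ same c gc<fc)

Box : ℕ → ℕ → ℕ → ℕ → ℕ → ℕ → Set
Box c d lo hi p q = (c < p × p ≤ d) × (lo < q × q ≤ hi)

box? : ∀ c d lo hi p q → Dec (Box c d lo hi p q)
box? c d lo hi p q = ((c <? p) ×-dec (p ≤? d)) ×-dec ((lo <? q) ×-dec (q ≤? hi))

𝟙-<-split : ∀ {lo hi} q → lo < hi → 𝟙 (lo <? q) ≡ 𝟙 (hi <? q) + 𝟙 ((lo <? q) ×-dec (q ≤? hi))
𝟙-<-split {lo} {hi} q lo<hi = sym (𝟙-⊎ (hi <? q) ((lo <? q) ×-dec (q ≤? hi)) (lo <? q)
  [ <-trans lo<hi , proj₁ ]
  (λ lo<q → [ inj₂ ∘ (lo<q ,_) , inj₁ ]′ (≤-<-connex q hi))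
  (λ (hi<q , _ , q≤hi) → <⇒≱ hi<q q≤hi))

module _ (f : ℕ → ℕ) {c d : ℕ} (c<d : c < d) (fc<fd : f c < f d) where

  private
    g = f ∘ t c d
    box = λ p q → 𝟙 (box? c d (f c) (f d) p q)
    between = λ q → 𝟙 ((f c <? q) ×-dec (q ≤? f d))

    box-inside : ∀ {p} q → c < p → p ≤ d → box p q ≡ between q
    box-inside q c<p p≤d = 𝟙-cong (box? c d (f c) (f d) _ q) ((f c <? q) ×-dec (q ≤? f d)) proj₂ ((c<p , p≤d) ,_)

    box-outside : ∀ {p} q → ¬ (c < p × p ≤ d) → box p q ≡ 0
    box-outside q out = 𝟙-no (box? c d (f c) (f d) _ q) (out ∘ proj₁)

    rank-transpose-step : ∀ p q → 𝟙 (f p <? q) + box p q ≡ 𝟙 (g p <? q) + box (suc p) q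
    rank-transpose-step p q with p ≟ c | p ≟ d
    ... | yes refl | _ = begin
      𝟙 (f c <? q) + box c q         ≡⟨ cong₂ _+_ (𝟙-<-split q fc<fd) (box-outside q (<-irrefl refl ∘ proj₁)) ⟩
      𝟙 (f d <? q) + between q + 0   ≡⟨ +-identityʳ _ ⟩
      𝟙 (f d <? q) + between q       ≡⟨ cong₂ _+_ (cong (λ y → 𝟙 (f y <? q)) (sym (t-fst c d)))
                                                  (sym (box-inside q ≤-refl c<d)) ⟩
      𝟙 (g c <? q) + box (suc c) q   ∎
      where open ≡-Reasoning
    ... | no _ | yes refl = begin
      𝟙 (f d <? q) + box d q         ≡⟨ cong (𝟙 (f d <? q) +_) (box-inside q c<d ≤-refl) ⟩
      𝟙 (f d <? q) + between q       ≡⟨ sym (𝟙-<-split q fc<fd) ⟩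
      𝟙 (f c <? q)                   ≡⟨ sym (+-identityʳ _) ⟩
      𝟙 (f c <? q) + 0               ≡⟨ cong₂ _+_ (cong (λ y → 𝟙 (f y <? q)) (sym (t-snd c d)))
                                                  (sym (box-outside q (<-irrefl refl ∘ proj₂))) ⟩
      𝟙 (g d <? q) + box (suc d) q   ∎
      where open ≡-Reasoning
    ... | no p≢c | no p≢d = cong₂ _+_ (cong (λ y → 𝟙 (f y <? q)) (sym (t-fix c d p p≢c p≢d)))
            (𝟙-cong (box? c d (f c) (f d) p q) (box? c d (f c) (f d) (suc p) q)
              (λ ((c<p , p≤d) , r) → (m<n⇒m<1+n c<p , ≤∧≢⇒< p≤d p≢d) , r)
              (λ ((c<1+p , p<d) , r) → (≤∧≢⇒< (≤-pred c<1+p) (p≢c ∘ sym) , <⇒≤ p<d) , r))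

  rank-transpose : ∀ p q → rank f p q ≡ rank (f ∘ t c d) p q + 𝟙 (box? c d (f c) (f d) p q)
  rank-transpose zero    q = sym (box-outside {0} q (λ ()))
  rank-transpose (suc p) q = begin
    𝟙 (f p <? q) + rank f p q                     ≡⟨ cong (𝟙 (f p <? q) +_) (rank-transpose p q) ⟩
    𝟙 (f p <? q) + (rank g p q + box p q)         ≡⟨ x∙yz≈xz∙y (𝟙 (f p <? q)) (rank g p q) (box p q) ⟩
    (𝟙 (f p <? q) + box p q) + rank g p q         ≡⟨ cong (_+ rank g p q) (rank-transpose-step p q) ⟩
    (𝟙 (g p <? q) + box (suc p) q) + rank g p q   ≡⟨ xy∙z≈xz∙y (𝟙 (g p <? q)) (box (suc p) q) (rank g p q) ⟩
    (𝟙 (g p <? q) + rank g p q) + box (suc p) q   ∎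
    where open ≡-Reasoning

rank-split : ∀ f p {lo hi} → lo ≤ hi →
             rank f p lo + count (λ x → (lo ≤? f x) ×-dec (f x <? hi)) p ≡ rank f p hi
rank-split f p {lo} lo≤hi = count-⊎ _ _ _ p
  (λ x → [ (λ fx<lo → <-≤-trans fx<lo lo≤hi) , proj₂ ])
  (λ x fx<hi → [ inj₂ ∘ (_, fx<hi) , inj₁ ]′ (≤-<-connex lo (f x)))
  (λ x (fx<lo , lo≤fx , _) → <⇒≱ fx<lo lo≤fx)

≤B-respˡ : ∀ {u u′ v} → u ≗ u′ → u′ ≤B v → u ≤B v
≤B-respˡ u≗u′ (≤B-refl u′≗v)   = ≤B-refl (λ x → trans (u≗u′ x) (u′≗v x))
≤B-respˡ u≗u′ (≤B-step u′≤x s) = ≤B-step (≤B-respˡ u≗u′ u′≤x) s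

≤B-respʳ : ∀ {u v v′} → u ≤B v → v ≗ v′ → u ≤B v′
≤B-respʳ (≤B-refl u≗v) v≗v′ = ≤B-refl (λ x → trans (u≗v x) (v≗v′ x))
≤B-respʳ (≤B-step u≤x (a , b , a<b , xa<xb , v≗xt)) v≗v′ =
  ≤B-step u≤x (a , b , a<b , xa<xb , λ x → trans (sym (v≗v′ x)) (v≗xt x))

≤B-trans : ∀ {u x v} → u ≤B x → x ≤B v → u ≤B v
≤B-trans u≤x (≤B-refl x≗v)   = ≤B-respʳ u≤x x≗v
≤B-trans u≤x (≤B-step x≤y s) = ≤B-step (≤B-trans u≤x x≤y) s

BStep⇒≤B : ∀ {u v} → BStep u v → u ≤B v
BStep⇒≤B = ≤B-step (≤B-refl (λ _ → refl))

BStep⇒rank≥ : ∀ {u v} → BStep u v → ∀ p q → rank v p q ≤ rank u p q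
BStep⇒rank≥ {u} (a , b , a<b , ua<ub , v≗ut) p q = begin
  rank _ p q             ≡⟨ rank-cong v≗ut p q ⟩
  rank (u ∘ t a b) p q   ≤⟨ m≤m+n _ _ ⟩
  _                      ≡⟨ rank-transpose u a<b ua<ub p q ⟨
  rank u p q             ∎
  where open ≤-Reasoning

≤B⇒rank≥ : ∀ {u v} → u ≤B v → ∀ p q → rank v p q ≤ rank u p q
≤B⇒rank≥ (≤B-refl u≗v)   p q = ≤-reflexive (rank-cong (λ x → sym (u≗v x)) p q)
≤B⇒rank≥ (≤B-step u≤x s) p q = ≤-trans (BStep⇒rank≥ s p q) (≤B⇒rank≥ u≤x p q)

least-below : {P : ℕ → Set ℓ} → Decidable P → ∀ n →
              (∃ λ b → b < n × P b × (∀ x → x < b → ¬ P x)) ⊎ (∀ x → x < n → ¬ P x)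
least-below P? zero = inj₂ (λ _ ())
least-below P? (suc n) with least-below P? n
... | inj₁ (b , b<n , Pb , below) = inj₁ (b , m<n⇒m<1+n b<n , Pb , below)
... | inj₂ none with P? n
...   | yes Pn = inj₁ (n , ≤-refl , Pn , none)
...   | no ¬Pn = inj₂ (λ x x<1+n → [ none x , (λ { refl → ¬Pn }) ]′ (m<1+n⇒m<n∨m≡n x<1+n))

least-witness : {P : ℕ → Set ℓ} → Decidable P → ∀ {n} → P n →
                ∃ λ b → b ≤ n × P b × (∀ x → x < b → ¬ P x)
least-witness P? {n} Pn with least-below P? (suc n)
... | inj₁ (b , b<1+n , Pb , below) = b , ≤-pred b<1+n , Pb , below
... | inj₂ none = ⊥-elim (none n ≤-refl Pn)

fun-injective : (u : Perm) → ∀ {a b} → fun u a ≡ fun u b → a ≡ b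
fun-injective u {a} {b} ua≡ub = begin
  a                ≡⟨ inv∘fun u a ⟨
  inv u (fun u a)  ≡⟨ cong (inv u) ua≡ub ⟩
  inv u (fun u b)  ≡⟨ inv∘fun u b ⟩
  b                ∎
  where open ≡-Reasoning

FixedFrom : ℕ → Perm → Set
FixedFrom M u = ∀ x → M ≤ x → fun u x ≡ x

FixedFrom-<-closed : ∀ {M} u → FixedFrom M u → ∀ {a} → a < M → fun u a < M
FixedFrom-<-closed {M} u fix {a} a<M with fun u a <? M
... | yes ua<M = ua<M
... | no ua≮M  = ⊥-elim (<⇒≱ a<M (subst (M ≤_) (fun-injective u (fix _ (≮⇒≥ ua≮M))) (≮⇒≥ ua≮M)))

_∘⟨_⇄_⟩ : Perm → ℕ → ℕ → Perm
u ∘⟨ a ⇄ b ⟩ = record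
  { fun     = fun u ∘ t a b
  ; inv     = t a b ∘ inv u
  ; fun∘inv = λ y → trans (cong (fun u) (t-involutive a b (inv u y))) (fun∘inv u y)
  ; inv∘fun = λ x → trans (cong (t a b) (inv∘fun u (t a b x))) (t-involutive a b x)
  ; bound   = bound u ⊔ suc a ⊔ suc b
  ; fixed   = λ x N≤x → trans (cong (fun u) (t-fix-from (≤-trans (m≤n⊔m _ (suc a)) (m≤m⊔n _ (suc b))) (m≤n⊔m _ (suc b)) N≤x))
                              (fixed u x (≤-trans (≤-trans (m≤m⊔n _ (suc a)) (m≤m⊔n _ (suc b))) N≤x))
  }

FixedFrom-∘⇄ : ∀ {M} u {a b} → FixedFrom M u → a < M → b < M → FixedFrom M (u ∘⟨ a ⇄ b ⟩)
FixedFrom-∘⇄ u fix a<M b<M x M≤x = trans (cong (fun u) (t-fix-from a<M b<M M≤x)) (fix x M≤x)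

rank-transpose-< : ∀ f {c d} → c < d → f c < f d → rank (f ∘ t c d) (suc c) (suc (f c)) < rank f (suc c) (suc (f c))
rank-transpose-< f {c} {d} c<d fc<fd = begin-strict
  rank g (suc c) (suc (f c))                  <⟨ n<1+n _ ⟩
  1 + rank g (suc c) (suc (f c))              ≡⟨ +-comm 1 _ ⟩
  rank g (suc c) (suc (f c)) + 1              ≡⟨ cong (rank g (suc c) (suc (f c)) +_) (𝟙-yes inBox? ((≤-refl , c<d) , (≤-refl , fc<fd))) ⟨
  rank g (suc c) (suc (f c)) + 𝟙 inBox?       ≡⟨ rank-transpose f c<d fc<fd (suc c) (suc (f c)) ⟨
  rank f (suc c) (suc (f c))                  ∎
  where
  open ≤-Reasoning
  g = f ∘ t c d
  inBox? = box? c d (f c) (f d) (suc c) (suc (f c))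

sumBelow : ℕ → (ℕ → ℕ) → ℕ
sumBelow zero    f = 0
sumBelow (suc n) f = f n + sumBelow n f

sumBelow-mono : ∀ n {f g} → (∀ x → x < n → f x ≤ g x) → sumBelow n f ≤ sumBelow n g
sumBelow-mono zero    f≤g = z≤n
sumBelow-mono (suc n) f≤g = +-mono-≤ (f≤g n ≤-refl) (sumBelow-mono n λ x x<n → f≤g x (m<n⇒m<1+n x<n))

sumBelow-strict : ∀ n {f g} → (∀ x → x < n → f x ≤ g x) → ∀ {y} → y < n → f y < g y → sumBelow n f < sumBelow n g
sumBelow-strict (suc n) f≤g {y} y<1+n fy<gy with m<1+n⇒m<n∨m≡n y<1+n
... | inj₂ refl = +-mono-<-≤ fy<gy (sumBelow-mono n λ x x<n → f≤g x (m<n⇒m<1+n x<n))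
... | inj₁ y<n  = +-mono-≤-< (f≤g n ≤-refl) (sumBelow-strict n (λ x x<n → f≤g x (m<n⇒m<1+n x<n)) y<n fy<gy)

rankWeight : ℕ → (ℕ → ℕ) → ℕ
rankWeight M f = sumBelow (suc M) λ p → sumBelow (suc M) λ q → rank f p q

rankWeight-strict : ∀ M {f g} → (∀ p q → rank f p q ≤ rank g p q) →
                    ∀ {p q} → p ≤ M → q ≤ M → rank f p q < rank g p q → rankWeight M f < rankWeight M g
rankWeight-strict M f≤g {p} p≤M q≤M f<g =
  sumBelow-strict (suc M) (λ p _ → sumBelow-mono (suc M) (λ q _ → f≤g p q)) (s≤s p≤M)
    (sumBelow-strict (suc M) (λ q _ → f≤g p q) (s≤s q≤M) f<g)

module RankCriterion {M : ℕ} (v : Perm) (v-fixed : FixedFrom M v) where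

  RankDominated : Perm → Set
  RankDominated u = ∀ p q → rank (fun v) p q ≤ rank (fun u) p q

  module Exchange (u : Perm) (u-fixed : FixedFrom M u) (dom : RankDominated u)
                  {a} (a<M : a < M) (ua≢va : fun u a ≢ fun v a) (agree : ∀ x → x < a → fun u x ≡ fun v x) where

    ua<va : fun u a < fun v a
    ua<va = ≤∧≢⇒< (≤-pred (1≤𝟙⇒ (fun u a <? suc (fun v a)) (+-cancelʳ-≤ _ _ _ (begin
      1 + rank (fun v) a (suc (fun v a))                    ≡⟨ cong (_+ rank (fun v) a (suc (fun v a)))
                                                                   (𝟙-yes (fun v a <? suc (fun v a)) ≤-refl) ⟨
      rank (fun v) (suc a) (suc (fun v a))                  ≤⟨ dom (suc a) (suc (fun v a)) ⟩
      rank (fun u) (suc a) (suc (fun v a))                  ≡⟨ cong (𝟙 (fun u a <? suc (fun v a)) +_) (rank-agree a agree _) ⟩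
      𝟙 (fun u a <? suc (fun v a)) + rank (fun v) a (suc (fun v a)) ∎))))
      ua≢va
      where open ≤-Reasoning

    Between : ℕ → Set
    Between x = a < x × fun u a < fun u x × fun u x ≤ fun v a

    preimage : Between (inv u (fun v a))
    preimage = a<B , subst (fun u a <_) (sym uB≡va) ua<va , ≤-reflexive uB≡va
      where
      uB≡va = fun∘inv u (fun v a)
      a<B : a < inv u (fun v a)
      a<B with <-cmp a (inv u (fun v a))
      ... | tri< a<B _ _ = a<B
      ... | tri≈ _ a≡B _ = ⊥-elim (ua≢va (trans (cong (fun u) a≡B) uB≡va))
      ... | tri> _ _ B<a = ⊥-elim (<-irrefl (fun-injective v (trans (sym (agree _ B<a)) uB≡va)) B<a)

    Between? : Decidable Between
    Between? x = (a <? x) ×-dec ((fun u a <? fun u x) ×-dec (fun u x ≤? fun v a))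

    private
      leftmost = least-witness Between? preimage

    b : ℕ
    b = proj₁ leftmost

    between-b : Between b
    between-b = proj₁ (proj₂ (proj₂ leftmost))

    a<b : a < b
    a<b = proj₁ between-b

    ua<ub : fun u a < fun u b
    ua<ub = proj₁ (proj₂ between-b)

    nothing-between-before-b : ∀ x → x < b → ¬ Between x
    nothing-between-before-b = proj₂ (proj₂ (proj₂ leftmost))

    b<M : b < M
    b<M = ≤-<-trans (proj₁ (proj₂ leftmost)) B<M
      where
      B<M : inv u (fun v a) < M
      B<M with inv u (fun v a) <? M
      ... | yes B<M = B<M
      ... | no B≮M = ⊥-elim (<⇒≱ (FixedFrom-<-closed v v-fixed a<M)
                       (subst (M ≤_) (trans (sym (u-fixed _ (≮⇒≥ B≮M))) (fun∘inv u (fun v a))) (≮⇒≥ B≮M)))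

    -- For a < p ≤ b and u a < q the window [q, v a] contains v a but no value of u at positions in [a, p).
    rank-strict-in-box : ∀ {p q} → a < p → p ≤ b → fun u a < q → q ≤ fun u b → rank (fun v) p q < rank (fun u) p q
    rank-strict-in-box {p} {q} a<p p≤b ua<q q≤ub = +-cancelʳ-≤ (window (fun v) a) _ _ (begin
      suc (rank (fun v) p q) + window (fun v) a   ≡⟨ +-suc (rank (fun v) p q) _ ⟨
      rank (fun v) p q + suc (window (fun v) a)   ≡⟨ cong (rank (fun v) p q +_) window-step ⟨
      rank (fun v) p q + window (fun v) (suc a)   ≤⟨ +-monoʳ-≤ (rank (fun v) p q) (count-mono (inWindow (fun v)) a<p) ⟩
      rank (fun v) p q + window (fun v) p         ≡⟨ rank-split (fun v) p q≤hi ⟩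
      rank (fun v) p hi                           ≤⟨ dom p hi ⟩
      rank (fun u) p hi                           ≡⟨ rank-split (fun u) p q≤hi ⟨
      rank (fun u) p q + window (fun u) p         ≡⟨ cong (rank (fun u) p q +_) (trans window-gap window-agree) ⟩
      rank (fun u) p q + window (fun v) a         ∎)
      where
      open ≤-Reasoning
      hi = suc (fun v a)
      q≤va = ≤-trans q≤ub (proj₂ (proj₂ between-b))
      q≤hi = m≤n⇒m≤1+n q≤va
      inWindow : (f : ℕ → ℕ) → Decidable (λ x → q ≤ f x × f x < hi)
      inWindow f x = (q ≤? f x) ×-dec (f x <? hi)
      window : (ℕ → ℕ) → ℕ → ℕ
      window f = count (inWindow f)
      window-gap : window (fun u) p ≡ window (fun u) a
      window-gap = count-gap (inWindow (fun u)) (<⇒≤ a<p) λ x a≤x x<p (q≤ux , ux<hi) →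
        [ (λ a<x → nothing-between-before-b x (<-≤-trans x<p p≤b) (a<x , <-≤-trans ua<q q≤ux , ≤-pred ux<hi))
        , (λ { refl → <⇒≱ ua<q q≤ux }) ]′ (m≤n⇒m<n∨m≡n a≤x)
      window-agree : window (fun u) a ≡ window (fun v) a
      window-agree = count-cong (inWindow (fun u)) (inWindow (fun v)) a
        (λ x x<a → subst (λ y → q ≤ y × y < hi) (agree x x<a))
        (λ x x<a → subst (λ y → q ≤ y × y < hi) (sym (agree x x<a)))
      window-step : window (fun v) (suc a) ≡ suc (window (fun v) a)
      window-step = cong (_+ window (fun v) a) (𝟙-yes (inWindow (fun v) a) (q≤va , ≤-refl))

    dominated-after-exchange : RankDominated (u ∘⟨ a ⇄ b ⟩)
    dominated-after-exchange p q
      with box? a b (fun u a) (fun u b) p q | rank-transpose (fun u) a<b ua<ub p q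
    ... | no _ | split = subst (rank (fun v) p q ≤_) (trans split (+-identityʳ _)) (dom p q)
    ... | yes ((a<p , p≤b) , (ua<q , q≤ub)) | split =
      +-cancelʳ-≤ 1 _ _ (subst (rank (fun v) p q + 1 ≤_) split
        (subst (_≤ rank (fun u) p q) (+-comm 1 _) (rank-strict-in-box a<p p≤b ua<q q≤ub)))

  rank-dominated⇒≤B : ∀ n (u : Perm) → rankWeight M (fun u) < n → FixedFrom M u → RankDominated u → fun u ≤B fun v
  rank-dominated⇒≤B (suc n) u weight<n u-fixed dom with least-below (λ x → ¬? (fun u x ≟ fun v x)) M
  ... | inj₂ agree-below-M = ≤B-refl λ x → [ (λ x<M → decidable-stable (fun u x ≟ fun v x) (agree-below-M x x<M))
                                             , (λ M≤x → trans (u-fixed x M≤x) (sym (v-fixed x M≤x))) ]′ (<-≤-connex x M)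
  ... | inj₁ (a , a<M , ua≢va , agree) =
    ≤B-trans (BStep⇒≤B exchange)
      (rank-dominated⇒≤B n (u ∘⟨ a ⇄ b ⟩)
        (<-≤-trans (rankWeight-strict M {fun u ∘ t a b} {fun u} (BStep⇒rank≥ exchange) a<M
                      (FixedFrom-<-closed u u-fixed a<M) (rank-transpose-< (fun u) a<b ua<ub)) (≤-pred weight<n))
        (FixedFrom-∘⇄ u u-fixed a<M b<M) dominated-after-exchange)
    where
    open Exchange u u-fixed dom a<M ua≢va (λ x x<a → decidable-stable (fun u x ≟ fun v x) (agree x x<a))
    exchange : BStep (fun u) (fun u ∘ t a b)
    exchange = a , b , a<b , ua<ub , λ _ → refl

rank≥⇒≤P : (u v : Perm) → (∀ p q → rank (fun v) p q ≤ rank (fun u) p q) → u ≤P v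
rank≥⇒≤P u v dom = RankCriterion.rank-dominated⇒≤B v (λ x M≤x → fixed v x (≤-trans (m≤n⊔m _ _) M≤x))
  (suc (rankWeight (bound u ⊔ bound v) (fun u))) u ≤-refl (λ x M≤x → fixed u x (≤-trans (m≤m⊔n _ _) M≤x)) dom

∉-above : ∀ {u us} → All (u <_) us → u ∉ us
∉-above (u<u ∷ _)    (here refl) = <-irrefl refl u<u
∉-above (_   ∷ u<us) (there u∈us) = ∉-above u<us u∈us

upTo-sorted : ∀ n → AllPairs _<_ (upTo n)
upTo-sorted n = AllPairs.applyUpTo⁺₁ (λ x → x) n (λ x<y _ → x<y)

select : (xs : List ℕ) → Subset (length xs) → List ℕ
select []       []          = []
select (x ∷ xs) (true ∷ S)  = x ∷ select xs S
select (x ∷ xs) (false ∷ S) = select xs S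

select-⊆ : ∀ xs S → select xs S ⊆L xs
select-⊆ []       []          ()
select-⊆ (x ∷ xs) (true ∷ S)  (here refl) = here refl
select-⊆ (x ∷ xs) (true ∷ S)  (there a∈)  = there (select-⊆ xs S a∈)
select-⊆ (x ∷ xs) (false ∷ S) a∈          = there (select-⊆ xs S a∈)

select-sorted : ∀ {xs} S → AllPairs _<_ xs → AllPairs _<_ (select xs S)
select-sorted []          []                = []
select-sorted (true ∷ S)  (x<xs ∷ sorted) = All.tabulate (All.lookup x<xs ∘ select-⊆ _ S) ∷ select-sorted S sorted
select-sorted (false ∷ S) (_ ∷ sorted)    = select-sorted S sorted

select-∷ : ∀ x xs t T → select xs T ⊆L select (x ∷ xs) (t ∷ T)
select-∷ x xs true  T = there
select-∷ x xs false T = λ a∈ → a∈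

select-∷⁻ : ∀ {x xs a} t T → a ∈ select (x ∷ xs) (t ∷ T) → a ≢ x → a ∈ select xs T
select-∷⁻ true  T (here refl) a≢x = ⊥-elim (a≢x refl)
select-∷⁻ true  T (there a∈)  _   = a∈
select-∷⁻ false T a∈          _   = a∈

select-mono : ∀ xs {S T} → S ⊆ₛ T → select xs S ⊆L select xs T
select-mono []       {[]}     {[]}    _   ()
select-mono (x ∷ xs) {true ∷ S} {t ∷ T} S⊆T (here refl) with S⊆T here
... | here = here refl
select-mono (x ∷ xs) {true ∷ S} {t ∷ T} S⊆T (there a∈) = select-∷ x xs t T (select-mono xs (drop-∷-⊆ S⊆T) a∈)
select-mono (x ∷ xs) {false ∷ S} {t ∷ T} S⊆T a∈ = select-∷ x xs t T (select-mono xs (drop-∷-⊆ S⊆T) a∈)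

select-reflects-⊆ : ∀ {xs} → AllPairs _<_ xs → ∀ {S T} → select xs S ⊆L select xs T → S ⊆ₛ T
select-reflects-⊆ {x ∷ xs} (x<xs ∷ _) {true ∷ S} {true ∷ T} _ here = here
select-reflects-⊆ {x ∷ xs} (x<xs ∷ _) {true ∷ S} {false ∷ T} S⊆T here =
  ⊥-elim (∉-above x<xs (select-⊆ xs T (S⊆T (here refl))))
select-reflects-⊆ {x ∷ xs} (x<xs ∷ sorted) {s ∷ S} {t ∷ T} S⊆T (there j∈S) =
  there (select-reflects-⊆ sorted (λ a∈S → select-∷⁻ t T (S⊆T (select-∷ x xs s S a∈S))
                                                      (λ { refl → ∉-above x<xs (select-⊆ xs S a∈S) })) j∈S)

mask : (xs : List ℕ) → List ℕ → Subset (length xs)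
mask []       U = []
mask (x ∷ xs) U = does (x ∈? U) ∷ mask xs U

select-mask-⊆ : ∀ xs U → select xs (mask xs U) ⊆L U
select-mask-⊆ (x ∷ xs) U a∈ with x ∈? U
select-mask-⊆ (x ∷ xs) U (here refl) | yes x∈U = x∈U
select-mask-⊆ (x ∷ xs) U (there a∈) | yes _    = select-mask-⊆ xs U a∈
select-mask-⊆ (x ∷ xs) U a∈         | no _     = select-mask-⊆ xs U a∈

∈-select-mask : ∀ xs U {a} → a ∈ U → a ∈ xs → a ∈ select xs (mask xs U)
∈-select-mask (x ∷ xs) U a∈U a∈xs with x ∈? U | a∈xs
... | yes _   | here refl = here refl
... | yes _   | there a∈  = there (∈-select-mask xs U a∈U a∈)
... | no  x∉U | here refl = ⊥-elim (x∉U a∈U)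
... | no  _   | there a∈  = ∈-select-mask xs U a∈U a∈

module Phi (w : Perm) (i : ℕ) where

  private
    W = fun w
    ω = W i

  InPhi-antitone : ∀ {a b} → InPhi w i a → InPhi w i b → a < b → W b < W a
  InPhi-antitone {a} {b} (i<a , ω<Wa , _) (_ , _ , nothing-between) a<b with <-cmp (W b) (W a)
  ... | tri< Wb<Wa _ _ = Wb<Wa
  ... | tri≈ _ Wb≡Wa _ = ⊥-elim (<-irrefl (fun-injective w (sym Wb≡Wa)) a<b)
  ... | tri> _ _ Wa<Wb = ⊥-elim (nothing-between a i<a a<b (ω<Wa , Wa<Wb))

  PhiList : List ℕ → Set
  PhiList U = AllPairs _<_ U × All (InPhi w i) U

  SubPhi⇒PhiList : ∀ {U} → SubPhi w i U → PhiList U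
  SubPhi⇒PhiList (linked , inPhi) = Linked⇒AllPairs <-trans linked , inPhi

  PhiList⇒SubPhi : ∀ {U} → PhiList U → SubPhi w i U
  PhiList⇒SubPhi (sorted , inPhi) = AllPairs⇒Linked sorted , inPhi

  PhiList-tail : ∀ {u us} → PhiList (u ∷ us) → PhiList us
  PhiList-tail (_ ∷ sorted , _ ∷ inPhi) = sorted , inPhi

  Region : List ℕ → ℕ → ℕ → Set
  Region U p q = Any (λ u → Box i u ω (W u) p q) U

  Region? : ∀ U p q → Dec (Region U p q)
  Region? U p q = any? (λ u → box? i u ω (W u) p q) U

  Region-mono : ∀ {U U′} → U ⊆L U′ → ∀ {p q} → Region U p q → Region U′ p q
  Region-mono U⊆U′ inU with find inU
  ... | u , u∈U , inBox = lose (U⊆U′ u∈U) inBox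

  wU-fix : ∀ U {x} → x ≢ i → x ∉ U → wU w i U x ≡ W x
  wU-fix []       _   _   = refl
  wU-fix (u ∷ us) x≢i x∉U = trans (cong (wU w i us) (t-fix i u _ x≢i (x∉U ∘ here))) (wU-fix us x≢i (x∉U ∘ there))

  headValue : List ℕ → ℕ
  headValue []      = ω
  headValue (u ∷ _) = W u

  wU-at-i : ∀ {U} → PhiList U → wU w i U i ≡ headValue U
  wU-at-i {[]}     _ = refl
  wU-at-i {u ∷ us} (u<us ∷ _ , (i<u , _) ∷ _) =
    trans (cong (wU w i us) (t-fst i u)) (wU-fix us (λ { refl → <-irrefl refl i<u }) (∉-above u<us))

  ω≤headValue : ∀ {U} → PhiList U → ω ≤ headValue U
  ω≤headValue {[]}    _                       = ≤-refl
  ω≤headValue {_ ∷ _} (_ , (_ , ω<Wu , _) ∷ _) = <⇒≤ ω<Wu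

  headValue-max : ∀ {U} → PhiList U → ∀ {u} → u ∈ U → W u ≤ headValue U
  headValue-max _                       (here refl)   = ≤-refl
  headValue-max (v<us ∷ _ , v∈φ ∷ us∈φ) (there u∈us) =
    <⇒≤ (InPhi-antitone v∈φ (All.lookup us∈φ u∈us) (All.lookup v<us u∈us))

  headValue-tail< : ∀ {u us} → PhiList (u ∷ us) → headValue us < W u
  headValue-tail< {us = []}    (_ , (_ , ω<Wu , _) ∷ _)       = ω<Wu
  headValue-tail< {us = _ ∷ _} ((u<v ∷ _) ∷ _ , u∈φ ∷ v∈φ ∷ _) = InPhi-antitone u∈φ v∈φ u<v

  Region-∷⁺ : ∀ {u us p q} → PhiList (u ∷ us) → Box i u (headValue us) (W u) p q ⊎ Region us p q → Region (u ∷ us) p q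
  Region-∷⁺ sorted (inj₁ (p∈ , head<q , q≤Wu)) = here (p∈ , ≤-<-trans (ω≤headValue (PhiList-tail sorted)) head<q , q≤Wu)
  Region-∷⁺ _      (inj₂ inUs)                 = there inUs

  Region-∷⁻ : ∀ {u us p q} → PhiList (u ∷ us) → Region (u ∷ us) p q → Box i u (headValue us) (W u) p q ⊎ Region us p q
  Region-∷⁻ _ (there inUs) = inj₂ inUs
  Region-∷⁻ {us = []}    _ (here inBox) = inj₁ inBox
  Region-∷⁻ {us = v ∷ _} {q = q} ((u<v ∷ _) ∷ _ , _) (here (p∈@(i<p , p≤u) , ω<q , q≤Wu)) with W v <? q
  ... | yes Wv<q = inj₁ (p∈ , Wv<q , q≤Wu)
  ... | no  Wv≮q = inj₂ (here ((i<p , ≤-trans p≤u (<⇒≤ u<v)) , ω<q , ≮⇒≥ Wv≮q))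

  Region-∷-disjoint : ∀ {u us p q} → PhiList (u ∷ us) → ¬ (Box i u (headValue us) (W u) p q × Region us p q)
  Region-∷-disjoint sorted ((_ , head<q , _) , inUs) with find inUs
  ... | x , x∈us , (_ , _ , q≤Wx) = <⇒≱ head<q (≤-trans q≤Wx (headValue-max (PhiList-tail sorted) x∈us))

  rank-wU : ∀ {U} → PhiList U → ∀ p q → rank (wU w i U) p q + 𝟙 (Region? U p q) ≡ rank W p q
  rank-wU {[]}     _      p q = +-identityʳ _
  rank-wU {u ∷ us} sorted@(u<us ∷ _ , (i<u , _) ∷ _) p q = begin
    rank g p q + 𝟙 (Region? (u ∷ us) p q)           ≡⟨ cong (rank g p q +_) split ⟨
    rank g p q + (box (headValue us) (W u) + rest)  ≡⟨ +-assoc (rank g p q) _ _ ⟨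
    rank g p q + box (headValue us) (W u) + rest    ≡⟨ cong₂ (λ lo hi → rank g p q + box lo hi + rest) fi fu ⟨
    rank g p q + box (f i) (f u) + rest             ≡⟨ cong (_+ rest) (rank-transpose f i<u fi<fu p q) ⟨
    rank f p q + rest                               ≡⟨ rank-wU (PhiList-tail sorted) p q ⟩
    rank W p q                                      ∎
    where
    open ≡-Reasoning
    f = wU w i us
    g = f ∘ t i u
    box = λ lo hi → 𝟙 (box? i u lo hi p q)
    rest = 𝟙 (Region? us p q)
    fi : f i ≡ headValue us
    fi = wU-at-i (PhiList-tail sorted)
    fu : f u ≡ W u
    fu = wU-fix us (λ { refl → <-irrefl refl i<u }) (∉-above u<us)
    fi<fu : f i < f u
    fi<fu = subst₂ _<_ (sym fi) (sym fu) (headValue-tail< sorted)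
    split : box (headValue us) (W u) + rest ≡ 𝟙 (Region? (u ∷ us) p q)
    split = 𝟙-⊎ (box? i u (headValue us) (W u) p q) (Region? us p q) (Region? (u ∷ us) p q)
              (Region-∷⁺ sorted) (Region-∷⁻ sorted) (Region-∷-disjoint sorted)

  module _ {U U′} (sorted : PhiList U) (sorted′ : PhiList U′) {p q : ℕ} where

    private
      same-total : rank (wU w i U) p q + 𝟙 (Region? U p q) ≡ rank (wU w i U′) p q + 𝟙 (Region? U′ p q)
      same-total = trans (rank-wU sorted p q) (sym (rank-wU sorted′ p q))

    Region⊆⇒rank≥ : (Region U p q → Region U′ p q) → rank (wU w i U′) p q ≤ rank (wU w i U) p q
    Region⊆⇒rank≥ U⊆U′ = +-cancelʳ-≤ (𝟙 (Region? U′ p q)) _ _ (begin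
      rank (wU w i U′) p q + 𝟙 (Region? U′ p q) ≡⟨ same-total ⟨
      rank (wU w i U) p q + 𝟙 (Region? U p q)   ≤⟨ +-monoʳ-≤ _ (𝟙-mono (Region? U p q) (Region? U′ p q) U⊆U′) ⟩
      rank (wU w i U) p q + 𝟙 (Region? U′ p q)  ∎)
      where open ≤-Reasoning

    rank≥⇒Region⊆ : rank (wU w i U′) p q ≤ rank (wU w i U) p q → Region U p q → Region U′ p q
    rank≥⇒Region⊆ rank≥ inU = 1≤𝟙⇒ (Region? U′ p q) (+-cancelˡ-≤ (rank (wU w i U) p q) _ _ (begin
      rank (wU w i U) p q + 1                   ≡⟨ cong (rank (wU w i U) p q +_) (𝟙-yes (Region? U p q) inU) ⟨
      rank (wU w i U) p q + 𝟙 (Region? U p q)   ≡⟨ same-total ⟩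
      rank (wU w i U′) p q + 𝟙 (Region? U′ p q) ≤⟨ +-monoˡ-≤ _ rank≥ ⟩
      rank (wU w i U) p q + 𝟙 (Region? U′ p q)  ∎))
      where open ≤-Reasoning

  permU : List ℕ → Perm
  permU []       = w
  permU (u ∷ us) = permU us ∘⟨ i ⇄ u ⟩

  fun-permU : ∀ U → fun (permU U) ≗ wU w i U
  fun-permU []       x = refl
  fun-permU (u ∷ us) x = fun-permU us (t i u x)

  rank≥⇒wU-≤B : ∀ U U′ → (∀ p q → rank (wU w i U′) p q ≤ rank (wU w i U) p q) → wU w i U ≤B wU w i U′
  rank≥⇒wU-≤B U U′ rank≥ =
    ≤B-respˡ (λ x → sym (fun-permU U x)) (≤B-respʳ (rank≥⇒≤P (permU U) (permU U′) rank≥′) (fun-permU U′))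
    where
    rank≥′ : ∀ p q → rank (fun (permU U′)) p q ≤ rank (fun (permU U)) p q
    rank≥′ p q = subst₂ _≤_ (rank-cong (λ x → sym (fun-permU U′ x)) p q) (rank-cong (λ x → sym (fun-permU U x)) p q) (rank≥ p q)

  Region-corner : ∀ {a} → InPhi w i a → Box i a ω (W a) a (W a)
  Region-corner (i<a , ω<Wa , _) = (i<a , ≤-refl) , (ω<Wa , ≤-refl)

  Region-corner⇒∈ : ∀ {U a} → PhiList U → InPhi w i a → Region U a (W a) → a ∈ U
  Region-corner⇒∈ (_ , U∈φ) a∈φ inU with find inU
  ... | u , u∈U , ((_ , a≤u) , (_ , Wa≤Wu)) with m≤n⇒m<n∨m≡n a≤u
  ...   | inj₂ refl = u∈U
  ...   | inj₁ a<u  = ⊥-elim (<⇒≱ (InPhi-antitone a∈φ (All.lookup U∈φ u∈U) a<u) Wa≤Wu)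

  wU-≤B⇔⊆ : ∀ {U U′} → PhiList U → PhiList U′ → (wU w i U ≤B wU w i U′) ⇔ (U ⊆L U′)
  wU-≤B⇔⊆ {U} {U′} sorted sorted′ = mk⇔
    (λ U≤U′ {a} a∈U → let a∈φ = All.lookup (proj₂ sorted) a∈U in
      Region-corner⇒∈ sorted′ a∈φ
        (rank≥⇒Region⊆ sorted sorted′ (≤B⇒rank≥ U≤U′ a (W a)) (lose a∈U (Region-corner a∈φ))))
    (λ U⊆U′ → rank≥⇒wU-≤B U U′ λ p q → Region⊆⇒rank≥ sorted sorted′ {p} {q} (Region-mono U⊆U′))

  InPhi? : Decidable (InPhi w i)
  InPhi? a = map′
    (λ (i<a , ω<Wa , ¬blocked) → i<a , ω<Wa , λ a′ i<a′ a′<a between → ¬blocked (a′ , a′<a , i<a′ , between))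
    (λ (i<a , ω<Wa , none) → i<a , ω<Wa , λ (a′ , a′<a , i<a′ , between) → none a′ i<a′ a′<a between)
    ((i <? a) ×-dec ((ω <? W a) ×-dec ¬? (anyUpTo? (λ a′ → (i <? a′) ×-dec ((ω <? W a′) ×-dec (W a′ <? W a))) a)))

  private
    a₀ : ℕ
    a₀ = bound w ⊔ suc ω

    Wa₀≡a₀ : W a₀ ≡ a₀
    Wa₀≡a₀ = fixed w a₀ (m≤m⊔n _ _)

    i<a₀ : i < a₀
    i<a₀ with i <? bound w
    ... | yes i<bound = ≤-trans i<bound (m≤m⊔n _ _)
    ... | no  i≮bound = subst (λ x → suc x ≤ a₀) (fixed w i (≮⇒≥ i≮bound)) (m≤n⊔m _ _)

    ω<Wa₀ : ω < W a₀
    ω<Wa₀ = subst (ω <_) (sym Wa₀≡a₀) (m≤n⊔m _ _)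

  InPhi-bounded : ∀ {a} → InPhi w i a → a ≤ a₀
  InPhi-bounded {a} (i<a , ω<Wa , nothing-between) with a ≤? a₀
  ... | yes a≤a₀ = a≤a₀
  ... | no  a≰a₀ = ⊥-elim (nothing-between a₀ i<a₀ a₀<a (ω<Wa₀ , subst₂ _<_ (sym Wa₀≡a₀) (sym Wa≡a) a₀<a))
    where
    a₀<a = ≰⇒> a≰a₀
    Wa≡a = fixed w a (≤-trans (m≤m⊔n _ _) (<⇒≤ a₀<a))

  phiList : List ℕ
  phiList = filter InPhi? (upTo (suc a₀))

  phiList-PhiList : PhiList phiList
  phiList-PhiList = AllPairs.filter⁺ InPhi? (upTo-sorted (suc a₀)) , All.all-filter InPhi? (upTo (suc a₀))

  ∈-phiList : ∀ {a} → InPhi w i a → a ∈ phiList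
  ∈-phiList a∈φ = ∈-filter⁺ InPhi? (∈-upTo⁺ (s≤s (InPhi-bounded a∈φ))) a∈φ

  -- the leftmost position to the right of i with a larger value lies in φ
  some-InPhi : ∃ (InPhi w i)
  some-InPhi with least-witness (λ x → (i <? x) ×-dec (ω <? W x)) (i<a₀ , ω<Wa₀)
  ... | a , _ , (i<a , ω<Wa) , leftmost = a , i<a , ω<Wa , λ a′ i<a′ a′<a (ω<Wa′ , _) → leftmost a′ a′<a (i<a′ , ω<Wa′)

  v : Perm
  v = permU phiList

  singleton-PhiList : ∀ {a} → InPhi w i a → PhiList (a ∷ [])
  singleton-PhiList a∈φ = [] ∷ [] , a∈φ ∷ []

  ⊆-phiList : ∀ {U} → PhiList U → U ⊆L phiList
  ⊆-phiList (_ , U∈φ) u∈U = ∈-phiList (All.lookup U∈φ u∈U)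

  wU-≤B-v : ∀ {U} → PhiList U → wU w i U ≤B fun v
  wU-≤B-v sorted = ≤B-respʳ (Equivalence.from (wU-≤B⇔⊆ sorted phiList-PhiList) (⊆-phiList sorted)) (λ x → sym (fun-permU phiList x))

  Region-phiList-covered : ∀ p q → ∃ λ a → InPhi w i a × (Region phiList p q → Region (a ∷ []) p q)
  Region-phiList-covered p q with Region? phiList p q
  ... | yes inφ = let a , a∈φ , inBox = find inφ in a , All.lookup (proj₂ phiList-PhiList) a∈φ , λ _ → here inBox
  ... | no ¬inφ = proj₁ some-InPhi , proj₂ some-InPhi , λ inφ → ⊥-elim (¬inφ inφ)

  v-isJoin : IsJoin (InΦ w i) v
  v-isJoin = upper , least
    where
    upper : ∀ x → InΦ w i x → x ≤P v
    upper x (a , a∈φ , x≗wta) = ≤B-respˡ x≗wta (wU-≤B-v (singleton-PhiList a∈φ))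
    least : ∀ z → (∀ x → InΦ w i x → x ≤P z) → v ≤P z
    least z above = rank≥⇒≤P v z λ p q →
      let a , a∈φ , covered = Region-phiList-covered p q in begin
      rank (fun z) p q                ≤⟨ ≤B⇒rank≥ (above (w ∘⟨ i ⇄ a ⟩) (a , a∈φ , λ _ → refl)) p q ⟩
      rank (wU w i (a ∷ [])) p q      ≤⟨ Region⊆⇒rank≥ phiList-PhiList (singleton-PhiList a∈φ) covered ⟩
      rank (wU w i phiList) p q       ≡⟨ rank-cong (fun-permU phiList) p q ⟨
      rank (fun v) p q                ∎
      where open ≤-Reasoning

  after : ℕ → List ℕ → List ℕ
  after c = filter (c <?_)

  after-PhiList : ∀ {U} c → PhiList U → PhiList (after c U)
  after-PhiList c (sorted , U∈φ) = AllPairs.filter⁺ (c <?_) sorted , All.filter⁺ (c <?_) U∈φ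

  wU-after : ∀ {U c} → PhiList U → c ≡ i ⊎ c ∈ U → wU w i U c ≡ headValue (after c U)
  wU-after {[]}     _ (inj₁ refl) = refl
  wU-after {u ∷ us} sorted@(_ , (i<u , _) ∷ _) (inj₁ refl) =
    trans (wU-at-i sorted) (cong headValue (sym (filter-accept (i <?_) i<u)))
  wU-after {u ∷ us} sorted@(u<us ∷ _ , _) (inj₂ (here refl)) = begin
    wU w i us (t i u u)         ≡⟨ cong (wU w i us) (t-snd i u) ⟩
    wU w i us i                 ≡⟨ wU-at-i (PhiList-tail sorted) ⟩
    headValue us                ≡⟨ cong headValue (filter-all (u <?_) u<us) ⟨
    headValue (after u us)      ≡⟨ cong headValue (filter-reject (u <?_) (<-irrefl refl)) ⟨
    headValue (after u (u ∷ us)) ∎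
    where open ≡-Reasoning
  wU-after {u ∷ us} {c} sorted@(u<us ∷ _ , _ ∷ us∈φ) (inj₂ (there c∈us)) = begin
    wU w i us (t i u c)          ≡⟨ cong (wU w i us) (t-fix i u c (λ { refl → <-irrefl refl i<c }) (λ { refl → <-irrefl refl u<c })) ⟩
    wU w i us c                  ≡⟨ wU-after (PhiList-tail sorted) (inj₂ c∈us) ⟩
    headValue (after c us)       ≡⟨ cong headValue (filter-reject (c <?_) (<-asym u<c)) ⟨
    headValue (after c (u ∷ us)) ∎
    where
    open ≡-Reasoning
    u<c = All.lookup u<us c∈us
    i<c = proj₁ (All.lookup us∈φ c∈us)

  headValue-cases : ∀ V → headValue V ≡ ω ⊎ ∃ λ u → u ∈ V × headValue V ≡ W u
  headValue-cases []      = inj₁ refl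
  headValue-cases (u ∷ _) = inj₂ (u , here refl , refl)

  headValue-≤ : ∀ {x} V → ω ≤ x → (∀ {u} → u ∈ V → W u ≤ x) → headValue V ≤ x
  headValue-≤ []      ω≤x _    = ω≤x
  headValue-≤ (_ ∷ _) _   V≤x = V≤x (here refl)

  rank-v : ∀ p q → rank (fun v) p q + 𝟙 (Region? phiList p q) ≡ rank W p q
  rank-v p q = trans (cong (_+ 𝟙 (Region? phiList p q)) (rank-cong (fun-permU phiList) p q)) (rank-wU phiList-PhiList p q)

  -- rank w − rank (wU w i U ∘ t c d) is 𝟙 InBox + 𝟙 (Region U), and it is at most 𝟙 (Region phiList) ≤ 1:
  -- the box lies inside Region phiList and outside Region U, and its two corners then locate c and d.
  module IntervalStep {U} (sorted : PhiList U) {c d} (c<d : c < d) (β<γ : wU w i U c < wU w i U d)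
                      (below-v : ∀ p q → rank (fun v) p q ≤ rank (wU w i U ∘ t c d) p q) where

    private
      y = wU w i U
      β = y c
      γ = y d
      g = y ∘ t c d

    InBox : ℕ → ℕ → Set
    InBox = Box c d β γ

    InBox? : ∀ p q → Dec (InBox p q)
    InBox? = box? c d β γ

    rank-exchanged-total : ∀ p q → rank g p q + (𝟙 (InBox? p q) + 𝟙 (Region? U p q)) ≡ rank W p q
    rank-exchanged-total p q = begin
      rank g p q + (𝟙 (InBox? p q) + 𝟙 (Region? U p q))   ≡⟨ +-assoc (rank g p q) _ _ ⟨
      rank g p q + 𝟙 (InBox? p q) + 𝟙 (Region? U p q)     ≡⟨ cong (_+ 𝟙 (Region? U p q)) (rank-transpose y c<d β<γ p q) ⟨
      rank y p q + 𝟙 (Region? U p q)                      ≡⟨ rank-wU sorted p q ⟩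
      rank W p q                                          ∎
      where open ≡-Reasoning

    box+U≤φ : ∀ p q → 𝟙 (InBox? p q) + 𝟙 (Region? U p q) ≤ 𝟙 (Region? phiList p q)
    box+U≤φ p q = +-cancelˡ-≤ (rank g p q) _ _ (begin
      rank g p q + (𝟙 (InBox? p q) + 𝟙 (Region? U p q))   ≡⟨ rank-exchanged-total p q ⟩
      rank W p q                                          ≡⟨ rank-v p q ⟨
      rank (fun v) p q + 𝟙 (Region? phiList p q)          ≤⟨ +-monoˡ-≤ _ (below-v p q) ⟩
      rank g p q + 𝟙 (Region? phiList p q)                ∎)
      where open ≤-Reasoning

    InBox⇒Region-φ : ∀ {p q} → InBox p q → Region phiList p q
    InBox⇒Region-φ {p} {q} inBox = 1≤𝟙⇒ (Region? phiList p q)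
      (≤-trans (≤-trans (≤-reflexive (sym (𝟙-yes (InBox? p q) inBox))) (m≤m+n _ _)) (box+U≤φ p q))

    InBox⇒¬Region-U : ∀ {p q} → InBox p q → ¬ Region U p q
    InBox⇒¬Region-U {p} {q} inBox inU = 1+n≰n (begin
      2                                                   ≡⟨ cong₂ _+_ (𝟙-yes (InBox? p q) inBox) (𝟙-yes (Region? U p q) inU) ⟨
      𝟙 (InBox? p q) + 𝟙 (Region? U p q)                  ≤⟨ box+U≤φ p q ⟩
      𝟙 (Region? phiList p q)                             ≤⟨ 𝟙≤1 (Region? phiList p q) ⟩
      1                                                   ∎)
      where open ≤-Reasoning

    private
      low-corner = find (InBox⇒Region-φ {suc c} {suc β} ((≤-refl , c<d) , (≤-refl , β<γ)))
      a = proj₁ low-corner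
      a∈φ = All.lookup (proj₂ phiList-PhiList) (proj₁ (proj₂ low-corner))
      high-corner = find (InBox⇒Region-φ {d} {γ} ((c<d , ≤-refl) , (β<γ , ≤-refl)))
      a′ = proj₁ high-corner
      a′∈φ = All.lookup (proj₂ phiList-PhiList) (proj₁ (proj₂ high-corner))

    i≤c : i ≤ c
    i≤c = ≤-pred (proj₁ (proj₁ (proj₂ (proj₂ low-corner))))

    ω≤β : ω ≤ β
    ω≤β = ≤-pred (proj₁ (proj₂ (proj₂ (proj₂ low-corner))))

    i<d : i < d
    i<d = ≤-<-trans i≤c c<d

    c≡i⊎c∈U : c ≡ i ⊎ c ∈ U
    c≡i⊎c∈U with c ≟ i | c ∈? U
    ... | yes c≡i | _      = inj₁ c≡i
    ... | no _    | yes c∈U = inj₂ c∈U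
    ... | no c≢i  | no c∉U  = ⊥-elim (proj₂ (proj₂ a∈φ) c i<c c<a (ω<Wc , subst (_< W a) β≡Wc β<Wa))
      where
      c<a = proj₂ (proj₁ (proj₂ (proj₂ low-corner)))
      β<Wa = proj₂ (proj₂ (proj₂ (proj₂ low-corner)))
      β≡Wc = wU-fix U c≢i c∉U
      i<c = ≤∧≢⇒< i≤c (c≢i ∘ sym)
      ω<Wc = ≤∧≢⇒< (subst (ω ≤_) β≡Wc ω≤β) (c≢i ∘ sym ∘ fun-injective w)

    β≡head : β ≡ headValue (after c U)
    β≡head = wU-after sorted c≡i⊎c∈U

    d∉U : d ∉ U
    d∉U d∈U = <⇒≱ β<γ (begin
      γ                        ≡⟨ wU-after sorted (inj₂ d∈U) ⟩
      headValue (after d U)    ≤⟨ headValue-≤ (after d U) ω≤β after-d≤β ⟩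
      β                        ∎)
      where
      open ≤-Reasoning
      after-d≤β : ∀ {u} → u ∈ after d U → W u ≤ β
      after-d≤β {u} u∈ with ∈-filter⁻ (d <?_) {xs = U} u∈
      ... | u∈U , d<u = subst (W u ≤_) (sym β≡head)
                          (headValue-max (after-PhiList c sorted) (∈-filter⁺ (c <?_) u∈U (<-trans c<d d<u)))

    γ≡Wd : γ ≡ W d
    γ≡Wd = wU-fix U (λ { refl → <-irrefl refl i<d }) d∉U

    d∈φ : InPhi w i d
    d∈φ with m≤n⇒m<n∨m≡n (proj₂ (proj₁ (proj₂ (proj₂ high-corner))))
    ... | inj₂ d≡a′ = subst (InPhi w i) (sym d≡a′) a′∈φ
    ... | inj₁ d<a′ = ⊥-elim (proj₂ (proj₂ a′∈φ) d i<d d<a′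
                        (subst (ω <_) γ≡Wd (≤-<-trans ω≤β β<γ) ,
                         ≤∧≢⇒< Wd≤Wa′ (λ Wd≡Wa′ → <-irrefl (fun-injective w Wd≡Wa′) d<a′)))
      where
      Wd≤Wa′ = subst (_≤ W a′) γ≡Wd (proj₂ (proj₂ (proj₂ (proj₂ high-corner))))

    module _ {p q} (inD : Box i d ω (W d) p q) (¬inU : ¬ Region U p q) where

      private
        i<p = proj₁ (proj₁ inD)
        p≤d = proj₂ (proj₁ inD)
        ω<q = proj₁ (proj₂ inD)
        q≤Wd = proj₂ (proj₂ inD)

      c<p : c < p
      c<p with c≡i⊎c∈U
      ... | inj₁ refl = i<p
      ... | inj₂ c∈U with c <? p
      ...   | yes c<p = c<p
      ...   | no  c≮p = ⊥-elim (¬inU (lose c∈U ((i<p , ≮⇒≥ c≮p) , (ω<q , ≤-trans q≤Wd (<⇒≤ Wd<Wc)))))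
        where Wd<Wc = InPhi-antitone (All.lookup (proj₂ sorted) c∈U) d∈φ c<d

      β<q : β < q
      β<q with headValue-cases (after c U)
      ... | inj₁ head≡ω = subst (_< q) (sym (trans β≡head head≡ω)) ω<q
      ... | inj₂ (u , u∈after , head≡Wu) with ∈-filter⁻ (c <?_) {xs = U} u∈after
      ...   | u∈U , _ with <-cmp u d
      ...     | tri≈ _ refl _ = ⊥-elim (d∉U u∈U)
      ...     | tri< u<d _ _  = ⊥-elim (<-asym (InPhi-antitone (All.lookup (proj₂ sorted) u∈U) d∈φ u<d)
                                  (subst₂ _<_ (trans β≡head head≡Wu) γ≡Wd β<γ))
      ...     | tri> _ _ d<u with W u <? q
      ...       | yes Wu<q = subst (_< q) (sym (trans β≡head head≡Wu)) Wu<q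
      ...       | no  Wu≮q = ⊥-elim (¬inU (lose u∈U ((i<p , ≤-trans p≤d (<⇒≤ d<u)) , (ω<q , ≮⇒≥ Wu≮q))))

    Region-extend⁺ : ∀ {p q} → InBox p q ⊎ Region U p q → Region (d ∷ U) p q
    Region-extend⁺ {q = q} (inj₁ ((c<p , p≤d) , (β<q , q≤γ))) =
      here ((≤-<-trans i≤c c<p , p≤d) , (≤-<-trans ω≤β β<q , subst (q ≤_) γ≡Wd q≤γ))
    Region-extend⁺ (inj₂ inU) = there inU

    Region-extend⁻ : ∀ {p q} → Region (d ∷ U) p q → InBox p q ⊎ Region U p q
    Region-extend⁻ (there inU) = inj₂ inU
    Region-extend⁻ {p} {q} (here inD) with Region? U p q
    ... | yes inU = inj₂ inU
    ... | no ¬inU = inj₁ ((c<p inD ¬inU , proj₂ (proj₁ inD)) , (β<q inD ¬inU , subst (q ≤_) (sym γ≡Wd) (proj₂ (proj₂ inD))))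

    rank-exchanged : ∀ p q → rank g p q + 𝟙 (Region? (d ∷ U) p q) ≡ rank W p q
    rank-exchanged p q = trans
      (cong (rank g p q +_) (sym (𝟙-⊎ (InBox? p q) (Region? U p q) (Region? (d ∷ U) p q)
        Region-extend⁺ Region-extend⁻ (λ (inBox , inU) → InBox⇒¬Region-U inBox inU))))
      (rank-exchanged-total p q)

  phiList∩_ : List ℕ → List ℕ
  phiList∩ U = filter (_∈? U) phiList

  phiList∩-PhiList : ∀ U → PhiList (phiList∩ U)
  phiList∩-PhiList U = AllPairs.filter⁺ (_∈? U) (proj₁ phiList-PhiList) , All.filter⁺ (_∈? U) (proj₂ phiList-PhiList)

  𝟙-Region-phiList∩ : ∀ {U} → All (InPhi w i) U → ∀ p q → 𝟙 (Region? (phiList∩ U) p q) ≡ 𝟙 (Region? U p q)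
  𝟙-Region-phiList∩ {U} U∈φ p q = 𝟙-cong (Region? (phiList∩ U) p q) (Region? U p q)
    (Region-mono (proj₂ ∘ ∈-filter⁻ (_∈? U) {xs = phiList}))
    (Region-mono (λ u∈U → ∈-filter⁺ (_∈? U) (∈-phiList (All.lookup U∈φ u∈U)) u∈U))

  interval⇒ : ∀ {y} → fun w ≤B y → (∀ p q → rank (fun v) p q ≤ rank y p q) → ∃ λ U → PhiList U × y ≗ wU w i U
  interval⇒ (≤B-refl w≗y) _ = [] , ([] , []) , λ x → sym (w≗y x)
  interval⇒ {y} (≤B-step {x = y₀} w≤y₀ step@(c , d , c<d , y₀c<y₀d , y≗y₀t)) below-v
    with interval⇒ w≤y₀ (λ p q → ≤-trans (below-v p q) (BStep⇒rank≥ step p q))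
  ... | U , sorted , y₀≗wU = U′ , phiList∩-PhiList (d ∷ U) , rank-injective same-rank
    where
    U′ = phiList∩ (d ∷ U)
    y≗wUt : y ≗ wU w i U ∘ t c d
    y≗wUt x = trans (y≗y₀t x) (y₀≗wU (t c d x))
    open IntervalStep sorted c<d (subst₂ _<_ (y₀≗wU c) (y₀≗wU d) y₀c<y₀d)
           (λ p q → subst (rank (fun v) p q ≤_) (rank-cong y≗wUt p q) (below-v p q))
    same-rank : ∀ p q → rank y p q ≡ rank (wU w i U′) p q
    same-rank p q = +-cancelʳ-≡ (𝟙 (Region? (d ∷ U) p q)) _ _ (begin
      rank y p q + 𝟙 (Region? (d ∷ U) p q)                   ≡⟨ cong (_+ 𝟙 (Region? (d ∷ U) p q)) (rank-cong y≗wUt p q) ⟩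
      rank (wU w i U ∘ t c d) p q + 𝟙 (Region? (d ∷ U) p q)   ≡⟨ rank-exchanged p q ⟩
      rank W p q                                             ≡⟨ rank-wU (phiList∩-PhiList (d ∷ U)) p q ⟨
      rank (wU w i U′) p q + 𝟙 (Region? U′ p q)               ≡⟨ cong (rank (wU w i U′) p q +_) (𝟙-Region-phiList∩ (d∈φ ∷ proj₂ sorted) p q) ⟩
      rank (wU w i U′) p q + 𝟙 (Region? (d ∷ U) p q)          ∎)
      where open ≡-Reasoning

  interval : ∀ x → ((w ≤P x) × (x ≤P v)) ⇔ InWΦ̄ w i x
  interval x = mk⇔ to from
    where
    to : (w ≤P x) × (x ≤P v) → InWΦ̄ w i x
    to (w≤x , x≤v) with interval⇒ w≤x (≤B⇒rank≥ x≤v)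
    ... | []    , _      , x≗w  = inj₁ x≗w
    ... | u ∷ U , sorted , x≗wU = inj₂ (u ∷ U , PhiList⇒SubPhi sorted , (λ ()) , x≗wU)
    from : InWΦ̄ w i x → (w ≤P x) × (x ≤P v)
    from (inj₁ x≗w) = ≤B-refl (λ a → sym (x≗w a)) , ≤B-respˡ x≗w (wU-≤B-v ([] , []))
    from (inj₂ (U , sub , _ , x≗wU)) =
      ≤B-respʳ (Equivalence.from (wU-≤B⇔⊆ ([] , []) sorted) (λ ())) (λ a → sym (x≗wU a)) , ≤B-respˡ x≗wU (wU-≤B-v sorted)
      where sorted = SubPhi⇒PhiList sub

  wU-cong-members : ∀ {U U′} → PhiList U → PhiList U′ → U ⊆L U′ → U′ ⊆L U → wU w i U ≗ wU w i U′
  wU-cong-members sorted sorted′ U⊆U′ U′⊆U = rank-injective λ p q →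
    ≤-antisym (Region⊆⇒rank≥ sorted′ sorted {p} {q} (Region-mono U′⊆U))
              (Region⊆⇒rank≥ sorted sorted′ {p} {q} (Region-mono U⊆U′))

  PhiList⇒InWΦ̄ : ∀ {U} → PhiList U → InWΦ̄ w i (permU U)
  PhiList⇒InWΦ̄ {[]}    _      = inj₁ (λ _ → refl)
  PhiList⇒InWΦ̄ {u ∷ U} sorted = inj₂ (u ∷ U , PhiList⇒SubPhi sorted , (λ ()) , fun-permU (u ∷ U))

  InWΦ̄⇒PhiList : ∀ {x} → InWΦ̄ w i x → ∃ λ U → PhiList U × fun x ≗ wU w i U
  InWΦ̄⇒PhiList (inj₁ x≗w)               = [] , ([] , []) , x≗w
  InWΦ̄⇒PhiList (inj₂ (U , sub , _ , x≗wU)) = U , SubPhi⇒PhiList sub , x≗wU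

  select-PhiList : ∀ S → PhiList (select phiList S)
  select-PhiList S = select-sorted S (proj₁ phiList-PhiList) , All.tabulate (All.lookup (proj₂ phiList-PhiList) ∘ select-⊆ phiList S)

  booleanLattice : IsBooleanLattice (InWΦ̄ w i)
  booleanLattice = length phiList , permU ∘ select phiList , PhiList⇒InWΦ̄ ∘ select-PhiList , onto , injective , order
    where
    order : ∀ S T → (permU (select phiList S) ≤P permU (select phiList T)) ⇔ (S ⊆ₛ T)
    order S T = mk⇔ reflects preserves
      where
      reflects : permU (select phiList S) ≤P permU (select phiList T) → S ⊆ₛ T
      reflects S≤T = select-reflects-⊆ (proj₁ phiList-PhiList)
        (Equivalence.to (wU-≤B⇔⊆ (select-PhiList S) (select-PhiList T))
          (≤B-respˡ (λ x → sym (fun-permU (select phiList S) x)) (≤B-respʳ S≤T (fun-permU (select phiList T)))))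
      preserves : S ⊆ₛ T → permU (select phiList S) ≤P permU (select phiList T)
      preserves S⊆T = ≤B-respˡ (fun-permU (select phiList S)) (≤B-respʳ
        (Equivalence.from (wU-≤B⇔⊆ (select-PhiList S) (select-PhiList T)) (select-mono phiList S⊆T))
        (λ x → sym (fun-permU (select phiList T) x)))
    injective : ∀ S T → fun (permU (select phiList S)) ≗ fun (permU (select phiList T)) → S ≡ T
    injective S T S≗T = ⊆-antisym (λ {j} → Equivalence.to (order S T) (≤B-refl S≗T) {j})
                                  (λ {j} → Equivalence.to (order T S) (≤B-refl (λ x → sym (S≗T x))) {j})
    onto : ∀ x → InWΦ̄ w i x → ∃ λ S → fun (permU (select phiList S)) ≗ fun x
    onto x x∈ with InWΦ̄⇒PhiList {x} x∈
    ... | U , sorted , x≗wU = mask phiList U , λ a → begin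
      fun (permU (select phiList (mask phiList U))) a  ≡⟨ fun-permU (select phiList (mask phiList U)) a ⟩
      wU w i (select phiList (mask phiList U)) a        ≡⟨ wU-cong-members (select-PhiList (mask phiList U)) sorted (select-mask-⊆ phiList U)
                                                             (λ u∈U → ∈-select-mask phiList U u∈U (⊆-phiList sorted u∈U)) a ⟩
      wU w i U a                                        ≡⟨ x≗wU a ⟨
      fun x a                                           ∎
      where open ≡-Reasoning

lemma5p10 : (w : Perm) (i : ℕ) →
    ( (∀ U U' → SubPhi w i U → SubPhi w i U' → ((wU w i U ≤B wU w i U') ⇔ (U ⊆L U')))
      × IsBooleanLattice (InWΦ̄ w i) )
    × Σ Perm (λ v → IsJoin (InΦ w i) v
        × (∀ x → ((w ≤P x) × (x ≤P v)) ⇔ InWΦ̄ w i x))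
lemma5p10 w i =
  ( (λ U U′ sub sub′ → wU-≤B⇔⊆ (SubPhi⇒PhiList sub) (SubPhi⇒PhiList sub′)) , booleanLattice )
  , v , v-isJoin , interval
  where open Phi w i
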